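{- Let $n\geq 2$ and $1\leq g\leq n-1$. The $g$-good-neighbour diagnosability of the $n$-dimensional hierarchical cubic network $HCN_{n}$ under the PMC model satisfies $t_{g}(HCN_{n})\leq 2^{g}(n+2-g)-1$.
   Context: For $n\ge 1$ let $V_n=\{0,1\}^n$; for $x\in V_n$, $\overline{x}$ denotes its bitwise complement. $HCN_n$ has vertex set $V_n\times V_n$. For each $x\in V_n$, the vertices $\{(x,y):y\in V_n\}$ induce a copy $xQ_n$ of the $n$-dimensional hypercube ($(x,y)\sim(x,y')$ iff $y,y'$ differ in exactly one bit). In addition, each vertex $(x,y)$ is joined to $(y,x)$ if $x\neq y$, and to $(\overline{x},\overline{y})$ if $x=y$. These are all the edges. A set $F\subset V(G)$ (proper subset) is a $g$-good-neighbour faulty set if every vertex of $V(G)\setminus F$ has at least $g$ neighbours in $V(G)\setminus F$. PMC model: for every ordered pair of adjacent vertices $(u,v)$, $u$ tests $v$; the outcome is $0$ if $u,v$ are both fault-free, $1$ if $u$ is fault-free and $v$ faulty, and arbitrary if $u$ is faulty. A syndrome is a collection of all test outcomes; $F$ is consistent with $\sigma$ if $\sigma$ can arise when exactly the vertices of $F$ are faulty. Distinct $F_1,F_2$ are distinguishable if no syndrome is consistent with both. $G$ is $g$-good-neighbour $t$-diagnosable if every two distinct $g$-good-neighbour faulty sets of size at most $t$ are distinguishable; $t_g(G)$ is the maximum such $t$. -}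

module Defs where

open import Data.Bool using (Bool; true; false; not; _∧_; _∨_; if_then_else_)
open import Data.Nat using (ℕ; zero; suc; _≤_; _≡ᵇ_)
open import Data.List using (List; []; _∷_; length; filterᵇ; map; concatMap)
open import Data.Vec using (Vec; []; _∷_)
open import Data.Product using (_×_; _,_; ∃; Σ)
open import Relation.Binary.PropositionalEquality using (_≡_; _≢_)
open import Relation.Nullary using (¬_; does)
import Data.Vec.Properties as VP
import Data.Bool.Properties as BP

record FinGraph : Set₁ where
  field
    Vertex   : Set
    vertices : List Vertex                 -- every vertex, each exactly once
    adj      : Vertex → Vertex → Bool

open FinGraph public

Subset : FinGraph → Set
Subset G = Vertex G → Bool

∣_∣ₛ : {G : FinGraph} → Subset G → ℕ
∣_∣ₛ {G} F = length (filterᵇ F (vertices G))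

outsideNbrs : (G : FinGraph) → Subset G → Vertex G → ℕ
outsideNbrs G F u = length (filterᵇ (λ v → adj G u v ∧ not (F v)) (vertices G))

GoodNeighbourFaulty : (G : FinGraph) → ℕ → Subset G → Set
GoodNeighbourFaulty G g F =
  (Σ (Vertex G) λ v → F v ≡ false) ×
  ((u : Vertex G) → F u ≡ false → g ≤ outsideNbrs G F u)

-- A syndrome assigns an outcome to every test (u tests v), i.e. to every
-- ordered pair of adjacent vertices.
Syndrome : FinGraph → Set
Syndrome G = (u v : Vertex G) → adj G u v ≡ true → Bool

-- Tests by faulty testers are arbitrary; a fault-free tester
-- reports 0 on a fault-free vertex and 1 on a faulty one.
Consistent : (G : FinGraph) → Subset G → Syndrome G → Set
Consistent G F σ = (u v : Vertex G) (e : adj G u v ≡ true) →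
  F u ≡ false → σ u v e ≡ F v

Distinct : (G : FinGraph) → Subset G → Subset G → Set
Distinct G F₁ F₂ = Σ (Vertex G) λ v → F₁ v ≢ F₂ v

Distinguishable : (G : FinGraph) → Subset G → Subset G → Set
Distinguishable G F₁ F₂ =
  (σ : Syndrome G) → ¬ (Consistent G F₁ σ × Consistent G F₂ σ)

GoodNeighbourDiagnosable : (G : FinGraph) → ℕ → ℕ → Set
GoodNeighbourDiagnosable G g t = (F₁ F₂ : Subset G) →
  GoodNeighbourFaulty G g F₁ → GoodNeighbourFaulty G g F₂ →
  ∣_∣ₛ {G} F₁ ≤ t → ∣_∣ₛ {G} F₂ ≤ t →
  Distinct G F₁ F₂ → Distinguishable G F₁ F₂

Bits : ℕ → Set
Bits n = Vec Bool n

allBits : (n : ℕ) → List (Bits n)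
allBits zero = [] ∷ []
allBits (suc n) = concatMap (λ xs → (false ∷ xs) ∷ (true ∷ xs) ∷ []) (allBits n)

complement : {n : ℕ} → Bits n → Bits n
complement [] = []
complement (b ∷ bs) = not b ∷ complement bs

hamming : {n : ℕ} → Bits n → Bits n → ℕ
hamming [] [] = 0
hamming (a ∷ as) (b ∷ bs) = if does (a BP.≟ b) then hamming as bs else suc (hamming as bs)

_=ᵇ_ : {n : ℕ} → Bits n → Bits n → Bool
x =ᵇ y = does (VP.≡-dec BP._≟_ x y)

HCNadj : {n : ℕ} → Bits n × Bits n → Bits n × Bits n → Bool
HCNadj (x , y) (x' , y') =
  -- hypercube edges inside the cluster xQ_n
  (x =ᵇ x' ∧ (hamming y y' ≡ᵇ 1)) ∨
  (not (x =ᵇ y) ∧ (x' =ᵇ y ∧ y' =ᵇ x)) ∨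
  (x =ᵇ y ∧ (x' =ᵇ complement x ∧ y' =ᵇ complement y))

HCN : ℕ → FinGraph
HCN n = record
  { Vertex   = Bits n × Bits n
  ; vertices = concatMap (λ x → map (λ y → (x , y)) (allBits n)) (allBits n)
  ; adj      = HCNadj
  }

-- Let A be the g-n+2∸g≡k+3al subcube of the cluster 1ⁿQₙ formed by the vertices (1ⁿ, y)
-- whose first n − g bits vanish, F₂ its closed and F₁ = F₂ ∖ A its open neighbourhood.
-- Besides A, F₂ contains the (n − g)·2ᵍ cluster neighbours of A and the 2ᵍ vertices (y, 1ⁿ)
-- joined to A by swap edges, so |F₂| = 2ᵍ(n + 2 − g). Both sets are g-good-neighbour
-- faulty: a fault-free vertex of 1ⁿQₙ keeps its cluster neighbours that flip one of the
-- last g bits, and a vertex of any other cluster loses at most the one cluster neighbour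
-- whose second coordinate is 1ⁿ. Every neighbour of A lies in F₂, so no vertex outside F₁ ∪ F₂ tests a vertex
-- of F₁ △ F₂ = A, and the two sets cannot be told apart: t_g(HCNₙ) < |F₂|.
module Submission where

open import Defs
open import Data.Bool using (Bool; true; false; not; _∧_; _∨_; if_then_else_)
import Data.Bool.Properties as BP
open import Data.List using (List; []; _∷_; length; filterᵇ; map; concatMap; _++_)
open import Data.List.Membership.Propositional using (_∈_)
open import Data.List.Membership.Propositional.Properties using (∈-concatMap⁺)
open import Data.List.Relation.Unary.Any using (here; there)
import Data.List.Relation.Unary.Any as Any
open import Data.Nat using (ℕ; zero; suc; _≤_; _<_; _+_; _*_; _∸_; _^_; _⊔_; z≤n; s≤s; _≡ᵇ_; _≤?_; s≤s⁻¹)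
open import Data.Nat.Properties
open import Data.Nat.Tactic.RingSolver using (solve-∀)
open import Data.Product using (_×_; _,_)
open import Data.Sum using (_⊎_; inj₁; inj₂)
open import Data.Vec using ([]; _∷_; replicate)
import Data.Vec.Properties as VP
open import Function using (_∘_)
open import Function.Bundles using (Equivalence)
open import Relation.Binary.PropositionalEquality
open import Relation.Nullary using (¬_; yes; no; contradiction)
open import Relation.Nullary.Decidable using (dec-true)

private
  variable
    A B : Set

∧-true : {a b : Bool} → a ∧ b ≡ true → a ≡ true × b ≡ true
∧-true {true} e = refl , e

∧-true³ : {a b c : Bool} → a ∧ (b ∧ c) ≡ true → a ≡ true × b ≡ true × c ≡ true
∧-true³ {true} {true} e = refl , refl , e

∨-true : {a b : Bool} → a ∨ b ≡ true → a ≡ true ⊎ b ≡ true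
∨-true {true}  _ = inj₁ refl
∨-true {false} e = inj₂ e

≡ᵇ-true⇒≡ : {m n : ℕ} → (m ≡ᵇ n) ≡ true → m ≡ n
≡ᵇ-true⇒≡ {m} {n} e = ≡ᵇ⇒≡ m n (Equivalence.from BP.T-≡ e)

count : {A : Set} → (A → Bool) → List A → ℕ
count p xs = length (filterᵇ p xs)

count-mono : {p q : A → Bool} → (∀ a → p a ≡ true → q a ≡ true) →
             (xs : List A) → count p xs ≤ count q xs
count-mono p⇒q [] = z≤n
count-mono {p = p} {q = q} p⇒q (x ∷ xs) with p x in px | q x in qx
... | true  | true  = s≤s (count-mono p⇒q xs)
... | true  | false with () ← trans (sym (p⇒q x px)) qx
... | false | true  = m≤n⇒m≤1+n (count-mono p⇒q xs)
... | false | false = count-mono p⇒q xs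

count-∨ : (p q : A → Bool) (xs : List A) →
          count (λ a → p a ∨ q a) xs ≤ count p xs + count q xs
count-∨ p q [] = z≤n
count-∨ p q (x ∷ xs) with p x | q x | count-∨ p q xs
... | true  | true  | ih = s≤s (≤-trans ih (+-monoʳ-≤ (count p xs) (n≤1+n _)))
... | true  | false | ih = s≤s ih
... | false | true  | ih = ≤-trans (s≤s ih) (≤-reflexive (sym (+-suc _ _)))
... | false | false | ih = ih

count-≤-∧-not : (p q : A → Bool) (xs : List A) →
                count p xs ≤ count q xs + count (λ a → p a ∧ not (q a)) xs
count-≤-∧-not p q xs =
  ≤-trans (count-mono split xs) (count-∨ q (λ a → p a ∧ not (q a)) xs)
  where
  split : ∀ a → p a ≡ true → (q a ∨ (p a ∧ not (q a))) ≡ true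
  split a pa with q a
  ... | true  = refl
  ... | false = trans (BP.∧-identityʳ (p a)) pa

count-false : (xs : List A) → count (λ _ → false) xs ≡ 0
count-false []       = refl
count-false (_ ∷ xs) = count-false xs

count-++ : (p : A → Bool) (xs ys : List A) →
           count p (xs ++ ys) ≡ count p xs + count p ys
count-++ p []       ys = refl
count-++ p (x ∷ xs) ys with p x
... | true  = cong suc (count-++ p xs ys)
... | false = count-++ p xs ys

count-map : (p : B → Bool) (f : A → B) (xs : List A) →
            count p (map f xs) ≡ count (p ∘ f) xs
count-map p f []       = refl
count-map p f (x ∷ xs) with p (f x)
... | true  = cong suc (count-map p f xs)
... | false = count-map p f xs

count-≤-concatMap : (p : B → Bool) (f : A → List B) {x : A} {xs : List A} →
                    x ∈ xs → count p (f x) ≤ count p (concatMap f xs)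
count-≤-concatMap p f {xs = y ∷ xs} (here refl)
  rewrite count-++ p (f y) (concatMap f xs) = m≤m+n _ _
count-≤-concatMap p f {xs = y ∷ xs} (there x∈xs)
  rewrite count-++ p (f y) (concatMap f xs) =
    ≤-trans (count-≤-concatMap p f x∈xs) (m≤n+m _ _)

_×ᵇ_ : (A → Bool) → (B → Bool) → A × B → Bool
(p ×ᵇ q) (x , y) = p x ∧ q y

pairs : List A → List B → List (A × B)
pairs xs ys = concatMap (λ x → map (x ,_) ys) xs

count-pairs : (p : A → Bool) (q : B → Bool) (xs : List A) (ys : List B) →
              count (p ×ᵇ q) (pairs xs ys) ≡ count p xs * count q ys
count-pairs p q []       ys = refl
count-pairs p q (x ∷ xs) ys
  rewrite count-++ (p ×ᵇ q) (map (x ,_) ys) (pairs xs ys)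
        | count-map (p ×ᵇ q) (x ,_) ys
        | count-pairs p q xs ys
  with p x
... | true  = refl
... | false = cong (_+ count p xs * count q ys) (count-false ys)

=ᵇ-refl : {n : ℕ} (x : Bits n) → (x =ᵇ x) ≡ true
=ᵇ-refl x = dec-true (VP.≡-dec BP._≟_ x x) refl

=ᵇ⇒≡ : {n : ℕ} {x y : Bits n} → (x =ᵇ y) ≡ true → x ≡ y
=ᵇ⇒≡ {x = []}        {[]}        _ = refl
=ᵇ⇒≡ {x = false ∷ x} {false ∷ y} e = cong (false ∷_) (=ᵇ⇒≡ e)
=ᵇ⇒≡ {x = true  ∷ x} {true  ∷ y} e = cong (true ∷_) (=ᵇ⇒≡ e)
=ᵇ⇒≡ {x = false ∷ x} {true  ∷ y} ()
=ᵇ⇒≡ {x = true  ∷ x} {false ∷ y} ()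

allBits-complete : {n : ℕ} (x : Bits n) → x ∈ allBits n
allBits-complete []          = here refl
allBits-complete (false ∷ x) =
  ∈-concatMap⁺ _ (Any.map (λ { refl → here refl }) (allBits-complete x))
allBits-complete (true  ∷ x) =
  ∈-concatMap⁺ _ (Any.map (λ { refl → there (here refl) }) (allBits-complete x))

count-allBits-suc : {n : ℕ} (p : Bits (suc n) → Bool) →
  count p (allBits (suc n)) ≡
  count (p ∘ (false ∷_)) (allBits n) + count (p ∘ (true ∷_)) (allBits n)
count-allBits-suc {n} p = go (allBits n)
  where
  go : (xss : List (Bits n)) →
       count p (concatMap (λ xs → (false ∷ xs) ∷ (true ∷ xs) ∷ []) xss) ≡
       count (p ∘ (false ∷_)) xss + count (p ∘ (true ∷_)) xss
  go []          = refl
  go (xs ∷ xss) with p (false ∷ xs)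
  ... | true  with p (true ∷ xs)
  ...   | true  = cong suc (trans (cong suc (go xss)) (sym (+-suc _ _)))
  ...   | false = cong suc (go xss)
  go (xs ∷ xss) | false with p (true ∷ xs)
  ...   | true  = trans (cong suc (go xss)) (sym (+-suc _ _))
  ...   | false = go xss

count-allBits : (n : ℕ) → count (λ _ → true) (allBits n) ≡ 2 ^ n
count-allBits zero = refl
count-allBits (suc n)
  rewrite count-allBits-suc {n} (λ _ → true) | count-allBits n | +-identityʳ (2 ^ n) = refl

count-=ᵇ : {n : ℕ} (z : Bits n) → count (_=ᵇ z) (allBits n) ≡ 1
count-=ᵇ [] = refl
count-=ᵇ {suc n} (false ∷ z)
  rewrite count-allBits-suc (_=ᵇ (false ∷ z)) | count-=ᵇ z | count-false (allBits n) = refl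
count-=ᵇ {suc n} (true ∷ z)
  rewrite count-allBits-suc (_=ᵇ (true ∷ z)) | count-=ᵇ z | count-false (allBits n) = refl

count-hamming≡0 : {n : ℕ} (y : Bits n) → count (λ y' → hamming y y' ≡ᵇ 0) (allBits n) ≡ 1
count-hamming≡0 [] = refl
count-hamming≡0 {suc n} (false ∷ y)
  rewrite count-allBits-suc (λ y' → hamming (false ∷ y) y' ≡ᵇ 0)
        | count-hamming≡0 y | count-false (allBits n) = refl
count-hamming≡0 {suc n} (true ∷ y)
  rewrite count-allBits-suc (λ y' → hamming (true ∷ y) y' ≡ᵇ 0)
        | count-hamming≡0 y | count-false (allBits n) = refl

count-hamming≡1 : {n : ℕ} (y : Bits n) → count (λ y' → hamming y y' ≡ᵇ 1) (allBits n) ≡ n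
count-hamming≡1 [] = refl
count-hamming≡1 {suc n} (false ∷ y)
  rewrite count-allBits-suc (λ y' → hamming (false ∷ y) y' ≡ᵇ 1)
        | count-hamming≡1 y | count-hamming≡0 y = +-comm n 1
count-hamming≡1 {suc n} (true ∷ y)
  rewrite count-allBits-suc (λ y' → hamming (true ∷ y) y' ≡ᵇ 1)
        | count-hamming≡1 y | count-hamming≡0 y = refl

prefixWeight : {n : ℕ} → ℕ → Bits n → ℕ
prefixWeight zero    _            = 0
prefixWeight (suc k) []           = 0
prefixWeight (suc k) (false ∷ bs) = prefixWeight k bs
prefixWeight (suc k) (true  ∷ bs) = suc (prefixWeight k bs)

prefixWeight-hamming : (k : ℕ) {n : ℕ} (y y' : Bits n) →
                       prefixWeight k y ≤ prefixWeight k y' + hamming y y'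
prefixWeight-hamming zero    y            y'            = z≤n
prefixWeight-hamming (suc k) []           []            = z≤n
prefixWeight-hamming (suc k) (false ∷ y)  (false ∷ y')  = prefixWeight-hamming k y y'
prefixWeight-hamming (suc k) (true  ∷ y)  (true  ∷ y')  = s≤s (prefixWeight-hamming k y y')
prefixWeight-hamming (suc k) (false ∷ y)  (true  ∷ y')  =
  ≤-trans (prefixWeight-hamming k y y') (+-mono-≤ (n≤1+n _) (n≤1+n _))
prefixWeight-hamming (suc k) (true  ∷ y)  (false ∷ y')  =
  ≤-trans (s≤s (prefixWeight-hamming k y y')) (≤-reflexive (sym (+-suc _ _)))

count-prefixWeight≡0 : (k g : ℕ) →
  count (λ y → prefixWeight k y ≡ᵇ 0) (allBits (k + g)) ≡ 2 ^ g
count-prefixWeight≡0 zero    g = count-allBits g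
count-prefixWeight≡0 (suc k) g
  rewrite count-allBits-suc {k + g} (λ y → prefixWeight (suc k) y ≡ᵇ 0)
        | count-prefixWeight≡0 k g | count-false (allBits (k + g)) = +-identityʳ _

count-prefixWeight≡1 : (k g : ℕ) →
  count (λ y → prefixWeight k y ≡ᵇ 1) (allBits (k + g)) ≡ k * 2 ^ g
count-prefixWeight≡1 zero    g = count-false (allBits g)
count-prefixWeight≡1 (suc k) g
  rewrite count-allBits-suc {k + g} (λ y → prefixWeight (suc k) y ≡ᵇ 1)
        | count-prefixWeight≡1 k g | count-prefixWeight≡0 k g = +-comm (k * 2 ^ g) _

count-weight-preserving-neighbours : (k : ℕ) {g : ℕ} (y : Bits (k + g)) →
  g ≤ count (λ y' → (hamming y y' ≡ᵇ 1) ∧ (prefixWeight k y' ≡ᵇ prefixWeight k y))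
            (allBits (k + g))
count-weight-preserving-neighbours zero {g} y =
  ≤-trans (≤-reflexive (sym (count-hamming≡1 y)))
          (count-mono (λ y' e → trans (BP.∧-identityʳ _) e) (allBits g))
count-weight-preserving-neighbours (suc k) {g} (false ∷ y)
  rewrite count-allBits-suc {k + g}
            (λ y' → (hamming (false ∷ y) y' ≡ᵇ 1) ∧ (prefixWeight (suc k) y' ≡ᵇ prefixWeight k y))
  = ≤-trans (count-weight-preserving-neighbours k y) (m≤m+n _ _)
count-weight-preserving-neighbours (suc k) {g} (true ∷ y)
  rewrite count-allBits-suc {k + g}
            (λ y' → (hamming (true ∷ y) y' ≡ᵇ 1) ∧ (prefixWeight (suc k) y' ≡ᵇ suc (prefixWeight k y)))
  = ≤-trans (count-weight-preserving-neighbours k y) (m≤n+m _ _)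

ones zeros : (n : ℕ) → Bits n
ones  n = replicate n true
zeros n = replicate n false

prefixWeight-zeros : (k n : ℕ) → prefixWeight k (zeros n) ≡ 0
prefixWeight-zeros zero    n       = refl
prefixWeight-zeros (suc k) zero    = refl
prefixWeight-zeros (suc k) (suc n) = prefixWeight-zeros k n

indistinguishable : (G : FinGraph) (F₁ F₂ : Subset G) →
  ((u v : Vertex G) → adj G u v ≡ true → F₁ u ≡ false → F₂ u ≡ false → F₁ v ≡ F₂ v) →
  ¬ Distinguishable G F₁ F₂
indistinguishable G F₁ F₂ agree distinguish = distinguish σ (consistent₁ , consistent₂)
  where
  σ : Syndrome G
  σ u v _ = if F₁ u then F₂ v else F₁ v

  consistent₁ : Consistent G F₁ σ
  consistent₁ u v e F₁u rewrite F₁u = refl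

  consistent₂ : Consistent G F₂ σ
  consistent₂ u v e F₂u with F₁ u in F₁u
  ... | true  = refl
  ... | false = agree u v e F₁u F₂u

diagnosable⇒<∣F₁∣⊔∣F₂∣ : (G : FinGraph) {g t : ℕ} {F₁ F₂ : Subset G} →
  GoodNeighbourFaulty G g F₁ → GoodNeighbourFaulty G g F₂ →
  Distinct G F₁ F₂ → ¬ Distinguishable G F₁ F₂ →
  GoodNeighbourDiagnosable G g t → t < ∣_∣ₛ {G} F₁ ⊔ ∣_∣ₛ {G} F₂
diagnosable⇒<∣F₁∣⊔∣F₂∣ G {t = t} {F₁} {F₂} good₁ good₂ F₁≢F₂ ¬distinguishable diagnosable
  with ∣_∣ₛ {G} F₁ ⊔ ∣_∣ₛ {G} F₂ ≤? t
... | no  ≰t = ≰⇒> ≰t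
... | yes ≤t = contradiction
  (diagnosable F₁ F₂ good₁ good₂ (≤-trans (m≤m⊔n _ _) ≤t) (≤-trans (m≤n⊔m _ _) ≤t) F₁≢F₂)
  ¬distinguishable

HCN-cluster-edge : {n : ℕ} (x y y' : Bits n) →
                   (hamming y y' ≡ᵇ 1) ≡ true → HCNadj (x , y) (x , y') ≡ true
HCN-cluster-edge x y y' h rewrite =ᵇ-refl x | h = refl

HCNadj-inversion : {n : ℕ} (x y x' y' : Bits n) → HCNadj (x , y) (x' , y') ≡ true →
  (x' ≡ x × hamming y y' ≡ 1) ⊎
  (x' ≡ y × y' ≡ x) ⊎
  (x ≡ y × x' ≡ complement x × y' ≡ complement y)
HCNadj-inversion x y x' y' e with ∨-true e
... | inj₁ cluster with (x≡x' , h) ← ∧-true cluster =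
  inj₁ (sym (=ᵇ⇒≡ x≡x') , ≡ᵇ-true⇒≡ h)
... | inj₂ e' with ∨-true e'
...   | inj₁ swap with (_ , x'≡y , y'≡x) ← ∧-true³ {not (x =ᵇ y)} swap =
  inj₂ (inj₁ (=ᵇ⇒≡ x'≡y , =ᵇ⇒≡ y'≡x))
...   | inj₂ diameter with (x≡y , x'≡x̄ , y'≡ȳ) ← ∧-true³ {x =ᵇ y} diameter =
  inj₂ (inj₂ (=ᵇ⇒≡ x≡y , =ᵇ⇒≡ x'≡x̄ , =ᵇ⇒≡ y'≡ȳ))

count-cluster-≤ : {n : ℕ} (P : Bits n × Bits n → Bool) (x : Bits n) →
                  count (λ y → P (x , y)) (allBits n) ≤ count P (vertices (HCN n))
count-cluster-≤ {n} P x =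
  subst (_≤ count P (vertices (HCN n))) (count-map P (x ,_) (allBits n))
        (count-≤-concatMap P (λ x → map (x ,_) (allBits n)) (allBits-complete x))

module SubcubeNeighbourhood (k g : ℕ) where

  n : ℕ
  n = suc (k + g)

  weight : Bits n → ℕ
  weight = prefixWeight (suc k)

  faulty : (ℕ → Bool) → Subset (HCN n)
  faulty c v = ((_=ᵇ ones n) ×ᵇ (c ∘ weight)) v ∨ ((λ x → weight x ≡ᵇ 0) ×ᵇ (_=ᵇ ones n)) v

  open-nbhd closed-nbhd : ℕ → Bool
  open-nbhd   m = m ≡ᵇ 1
  closed-nbhd m = (m ≡ᵇ 0) ∨ (m ≡ᵇ 1)

  -- A = {(1ⁿ , y) : weight y ≡ 0}, F₁ = N(A) and F₂ = N[A].
  F₁ F₂ : Subset (HCN n)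
  F₁ = faulty open-nbhd
  F₂ = faulty closed-nbhd

  faulty-ones : (c : ℕ → Bool) (y : Bits n) → faulty c (ones n , y) ≡ c (weight y)
  faulty-ones c y =
    trans (cong (λ b → (b ∧ c (weight y)) ∨ false) (=ᵇ-refl (ones n))) (BP.∨-identityʳ _)

  faulty-off-ones : (c : ℕ → Bool) (x y : Bits n) → (x =ᵇ ones n) ≡ false →
                    faulty c (x , y) ≡ (weight x ≡ᵇ 0) ∧ (y =ᵇ ones n)
  faulty-off-ones c x y off = cong (λ b → (b ∧ c (weight y)) ∨ ((weight x ≡ᵇ 0) ∧ (y =ᵇ ones n))) off

  degree-on-ones : (c : ℕ → Bool) (y : Bits n) → c (weight y) ≡ false →
                   g ≤ outsideNbrs (HCN n) (faulty c) (ones n , y)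
  degree-on-ones c y fault-free =
    ≤-trans (count-weight-preserving-neighbours (suc k) y)
      (≤-trans (count-mono fault-free-neighbour (allBits n)) (count-cluster-≤ _ (ones n)))
    where
    fault-free-neighbour : ∀ y' → ((hamming y y' ≡ᵇ 1) ∧ (weight y' ≡ᵇ weight y)) ≡ true →
      (HCNadj (ones n , y) (ones n , y') ∧ not (faulty c (ones n , y'))) ≡ true
    fault-free-neighbour y' e with (h , same) ← ∧-true e =
      cong₂ _∧_ (HCN-cluster-edge (ones n) y y' h) (cong not (begin
        faulty c (ones n , y') ≡⟨ faulty-ones c y' ⟩
        c (weight y')          ≡⟨ cong c (≡ᵇ-true⇒≡ same) ⟩
        c (weight y)           ≡⟨ fault-free ⟩
        false                  ∎))
      where open ≡-Reasoning

  degree-off-ones : (c : ℕ → Bool) (x y : Bits n) → (x =ᵇ ones n) ≡ false →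
                    g ≤ outsideNbrs (HCN n) (faulty c) (x , y)
  degree-off-ones c x y off =
    ≤-trans (m≤n+m g k)
      (≤-trans (s≤s⁻¹ (≤-trans (≤-reflexive (sym (count-hamming≡1 y))) split))
        (≤-trans (count-mono fault-free-neighbour (allBits n)) (count-cluster-≤ _ x)))
    where
    split : count (λ y' → hamming y y' ≡ᵇ 1) (allBits n) ≤
            1 + count (λ y' → (hamming y y' ≡ᵇ 1) ∧ not (y' =ᵇ ones n)) (allBits n)
    split = subst (λ m → count (λ y' → hamming y y' ≡ᵇ 1) (allBits n) ≤
                         m + count (λ y' → (hamming y y' ≡ᵇ 1) ∧ not (y' =ᵇ ones n)) (allBits n))
                  (count-=ᵇ (ones n))
                  (count-≤-∧-not (λ y' → hamming y y' ≡ᵇ 1) (_=ᵇ ones n) (allBits n))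
    fault-free-neighbour : ∀ y' → ((hamming y y' ≡ᵇ 1) ∧ not (y' =ᵇ ones n)) ≡ true →
      (HCNadj (x , y) (x , y') ∧ not (faulty c (x , y'))) ≡ true
    fault-free-neighbour y' e with (h , y'≢ones) ← ∧-true e =
      cong₂ _∧_ (HCN-cluster-edge x y y' h) (cong not (begin
        faulty c (x , y')                 ≡⟨ faulty-off-ones c x y' off ⟩
        (weight x ≡ᵇ 0) ∧ (y' =ᵇ ones n)  ≡⟨ cong (_ ∧_) (BP.not-injective y'≢ones) ⟩
        (weight x ≡ᵇ 0) ∧ false           ≡⟨ BP.∧-zeroʳ _ ⟩
        false                             ∎))
      where open ≡-Reasoning

  faulty-goodNeighbour : (c : ℕ → Bool) → GoodNeighbourFaulty (HCN n) g (faulty c)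
  faulty-goodNeighbour c = ((zeros n , zeros n) , BP.∧-zeroʳ _) , degree
    where
    degree : (u : Vertex (HCN n)) → faulty c u ≡ false → g ≤ outsideNbrs (HCN n) (faulty c) u
    degree (x , y) fault-free with x =ᵇ ones n in x?
    ... | true with refl ← =ᵇ⇒≡ {x = x} {ones n} x? =
      degree-on-ones c y (trans (sym (BP.∨-identityʳ _)) fault-free)
    ... | false = degree-off-ones c x y x?

  ∣faulty∣≤ : (c : ℕ → Bool) → ∣_∣ₛ {HCN n} (faulty c) ≤ count (c ∘ weight) (allBits n) + 2 ^ g
  ∣faulty∣≤ c = ≤-trans (count-∨ _ _ (vertices (HCN n))) (≤-reflexive (cong₂ _+_
    (begin
      count ((_=ᵇ ones n) ×ᵇ (c ∘ weight)) (vertices (HCN n))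
        ≡⟨ count-pairs (_=ᵇ ones n) (c ∘ weight) (allBits n) (allBits n) ⟩
      count (_=ᵇ ones n) (allBits n) * count (c ∘ weight) (allBits n)
        ≡⟨ cong (_* count (c ∘ weight) (allBits n)) (count-=ᵇ (ones n)) ⟩
      1 * count (c ∘ weight) (allBits n)
        ≡⟨ *-identityˡ _ ⟩
      count (c ∘ weight) (allBits n) ∎)
    (begin
      count ((λ x → weight x ≡ᵇ 0) ×ᵇ (_=ᵇ ones n)) (vertices (HCN n))
        ≡⟨ count-pairs (λ x → weight x ≡ᵇ 0) (_=ᵇ ones n) (allBits n) (allBits n) ⟩
      count (λ x → weight x ≡ᵇ 0) (allBits n) * count (_=ᵇ ones n) (allBits n)
        ≡⟨ cong₂ _*_ (count-prefixWeight≡0 (suc k) g) (count-=ᵇ (ones n)) ⟩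
      2 ^ g * 1
        ≡⟨ *-identityʳ _ ⟩
      2 ^ g ∎)))
    where open ≡-Reasoning

  ∣F₂∣≤ : ∣_∣ₛ {HCN n} F₂ ≤ 2 ^ g * (suc k + 2)
  ∣F₂∣≤ = begin
    ∣_∣ₛ {HCN n} F₂
      ≤⟨ ∣faulty∣≤ closed-nbhd ⟩
    count (closed-nbhd ∘ weight) (allBits n) + 2 ^ g
      ≤⟨ +-monoˡ-≤ (2 ^ g) (count-∨ (λ y → weight y ≡ᵇ 0) (λ y → weight y ≡ᵇ 1) (allBits n)) ⟩
    count (λ y → weight y ≡ᵇ 0) (allBits n) + count (λ y → weight y ≡ᵇ 1) (allBits n) + 2 ^ g
      ≡⟨ cong₂ (λ a b → a + b + 2 ^ g) (count-prefixWeight≡0 (suc k) g) (count-prefixWeight≡1 (suc k) g) ⟩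
    2 ^ g + suc k * 2 ^ g + 2 ^ g
      ≡⟨ regroup (2 ^ g) k ⟩
    2 ^ g * (suc k + 2) ∎
    where
    open ≤-Reasoning
    regroup : (p k : ℕ) → p + suc k * p + p ≡ p * (suc k + 2)
    regroup = solve-∀

  faulty-mono : {c c' : ℕ → Bool} → (∀ m → c m ≡ true → c' m ≡ true) →
                ∀ v → faulty c v ≡ true → faulty c' v ≡ true
  faulty-mono {c} {c'} c⇒c' (x , y) e with x =ᵇ ones n | c (weight y) in cy
  ... | false | _     = e
  ... | true  | true  rewrite c⇒c' _ cy = refl
  ... | true  | false = trans (cong (c' (weight y) ∨_) e) (BP.∨-zeroʳ _)

  ∣F₁∣≤∣F₂∣ : ∣_∣ₛ {HCN n} F₁ ≤ ∣_∣ₛ {HCN n} F₂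
  ∣F₁∣≤∣F₂∣ = count-mono (faulty-mono open⇒closed) (vertices (HCN n))
    where
    open⇒closed : ∀ m → open-nbhd m ≡ true → closed-nbhd m ≡ true
    open⇒closed (suc zero) _ = refl

  F₁≢F₂ : Distinct (HCN n) F₁ F₂
  F₁≢F₂ = (ones n , zeros n) , differ
    where
    differ : F₁ (ones n , zeros n) ≢ F₂ (ones n , zeros n)
    differ rewrite faulty-ones open-nbhd (zeros n) | faulty-ones closed-nbhd (zeros n)
                 | prefixWeight-zeros (suc k) n = λ ()

  InSubcube : Vertex (HCN n) → Set
  InSubcube (x , y) = x ≡ ones n × weight y ≡ 0

  F₁≡F₂-outside-subcube : (v : Vertex (HCN n)) → ¬ InSubcube v → F₁ v ≡ F₂ v
  F₁≡F₂-outside-subcube (x , y) ∉subcube with x =ᵇ ones n in x?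
  ... | false = refl
  ... | true with refl ← =ᵇ⇒≡ {x = x} {ones n} x? with weight y in w
  ...   | zero  = contradiction (refl , refl) ∉subcube
  ...   | suc _ = refl  -- open-nbhd and closed-nbhd agree on positive arguments

  subcube-neighbour∈F₂ : (u v : Vertex (HCN n)) → HCNadj u v ≡ true → InSubcube v → F₂ u ≡ true
  subcube-neighbour∈F₂ (x , y) (_ , y') e (refl , w') with HCNadj-inversion x y (ones n) y' e
  ... | inj₁ (refl , h) = trans (faulty-ones closed-nbhd y) (closed-nbhd-≤1 (begin
    weight y                      ≤⟨ prefixWeight-hamming (suc k) y y' ⟩
    weight y' + hamming y y'      ≡⟨ cong₂ _+_ w' h ⟩
    1                             ∎))
    where
    open ≤-Reasoning
    closed-nbhd-≤1 : {m : ℕ} → m ≤ 1 → closed-nbhd m ≡ true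
    closed-nbhd-≤1 z≤n       = refl
    closed-nbhd-≤1 (s≤s z≤n) = refl
  ... | inj₂ (inj₁ (refl , refl)) rewrite w' | =ᵇ-refl (ones n) = BP.∨-zeroʳ _
  ... | inj₂ (inj₂ (refl , ones≡x̄ , refl)) with () ← subst (λ z → weight z ≡ 0) (sym ones≡x̄) w'

  F₁≡F₂-beyond-fault-free : (u v : Vertex (HCN n)) → HCNadj u v ≡ true → F₂ u ≡ false → F₁ v ≡ F₂ v
  F₁≡F₂-beyond-fault-free u v e F₂u = F₁≡F₂-outside-subcube v λ v∈subcube →
    contradiction (trans (sym F₂u) (subcube-neighbour∈F₂ u v e v∈subcube)) λ ()

  diagnosability-< : (t : ℕ) → GoodNeighbourDiagnosable (HCN n) g t → t < 2 ^ g * (suc k + 2)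
  diagnosability-< t diagnosable = <-≤-trans
    (diagnosable⇒<∣F₁∣⊔∣F₂∣ (HCN n) (faulty-goodNeighbour open-nbhd) (faulty-goodNeighbour closed-nbhd)
      F₁≢F₂ (indistinguishable (HCN n) F₁ F₂ (λ u v e _ → F₁≡F₂-beyond-fault-free u v e)) diagnosable)
    (⊔-lub (≤-trans ∣F₁∣≤∣F₂∣ ∣F₂∣≤) ∣F₂∣≤)

-- The hypothesis 1 ≤ g is unused: the construction works for g = 0 as well.
theorem1 : (n g : ℕ) → 2 ≤ n → 1 ≤ g → g ≤ n ∸ 1 →
    (t : ℕ) → GoodNeighbourDiagnosable (HCN n) g t →
    t ≤ 2 ^ g * (n + 2 ∸ g) ∸ 1
theorem1 (suc m) g _ _ g≤m t diagnosable with m ∸ g | m∸n+n≡m g≤m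
... | k | refl = subst (λ b → t ≤ 2 ^ g * b ∸ 1) (sym n+2∸g≡k+3)
                      (∸-monoˡ-≤ 1 (SubcubeNeighbourhood.diagnosability-< k g t diagnosable))
  where
  regroup : ∀ k g → suc (k + g) + 2 ≡ suc k + 2 + g
  regroup = solve-∀

  n+2∸g≡k+3 : suc (k + g) + 2 ∸ g ≡ suc k + 2
  n+2∸g≡k+3 = trans (cong (_∸ g) (regroup k g)) (m+n∸n≡m (suc k + 2) g)
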